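{- Let $G=(V,E)$ be a graph and $X\subseteq V$, and let $\mathcal{S}$ be the set of all forts of $G$. Consider the integer program \[\min \sum_{v\in V}p_v \quad\text{subject to}\quad \sum_{v\in N[F]}p_v\ge 1\ \ \forall F\in\mathcal{S};\qquad p_v=1\ \ \forall v\in X;\qquad p_v\in\{0,1\}\ \ \forall v\in V.\] The optimum value of this integer program equals $\gamma_P(G;X)$.
   Context: All graphs are finite, simple and undirected. $N(v)$ denotes the set of neighbors of $v$, $N[v]=N(v)\cup\{v\}$, $N[S]=\bigcup_{v\in S}N[v]$. A fort of $G$ is a nonempty set $F\subseteq V$ such that no vertex outside $F$ is adjacent to exactly one vertex of $F$. For $S\subseteq V$, the set $PD(S)$ is defined by: initially $PD(S)=N[S]$; while there exists $v\in PD(S)$ with $|N(v)\setminus PD(S)|=1$, replace $PD(S)$ by $PD(S)\cup N(v)$. $S$ is a power dominating set of $G$ if at the end $PD(S)=V$. For $X\subseteq V$, $\gamma_P(G;X)$ is the minimum cardinality of a power dominating set of $G$ containing $X$. -}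

module Defs where

open import Data.Nat using (ℕ; zero; suc; _+_; _≤_)
open import Data.Bool using (Bool; true; false; if_then_else_)
open import Data.Fin using (Fin)
open import Data.Fin.Subset using (Subset; ⁅_⁆; _∈_; _∉_; _⊆_; _∪_; _∩_; _─_; ⋃; ∣_∣; Nonempty; ⊥; ⊤)
open import Data.List using (List; allFin; map)
open import Data.Nat.ListAction using (sum)
open import Data.Vec using (tabulate; lookup)
open import Data.Product using (Σ; ∃; _×_; _,_)
open import Data.Sum using (_⊎_)
open import Relation.Binary.PropositionalEquality using (_≡_; _≢_)

record Graph (n : ℕ) : Set where
  field
    adj     : Fin n → Fin n → Bool
    symm    : ∀ u v → adj u v ≡ adj v u
    irrefl  : ∀ v → adj v v ≡ false

module _ {n : ℕ} (G : Graph n) where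
  open Graph G

  N : Fin n → Subset n
  N v = tabulate (adj v)

  Nc : Fin n → Subset n
  Nc v = ⁅ v ⁆ ∪ N v

  NS : Subset n → Subset n
  NS S = ⋃ (map (λ v → if lookup S v then Nc v else ⊥) (allFin n))

  IsFort : Subset n → Set
  IsFort F = Nonempty F × (∀ v → v ∉ F → ∣ N v ∩ F ∣ ≢ 1)

  data PDRun (S : Subset n) : Subset n → Set where
    start : PDRun S (NS S)
    step  : ∀ {T} v → PDRun S T → v ∈ T → ∣ N v ─ T ∣ ≡ 1 → PDRun S (T ∪ N v)

  Halted : Subset n → Set
  Halted T = ∀ v → v ∈ T → ∣ N v ─ T ∣ ≢ 1

  IsPDS : Subset n → Set
  IsPDS S = ∀ T → PDRun S T → Halted T → T ≡ ⊤

  IsMin : (ℕ → Set) → ℕ → Set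
  IsMin P k = P k × (∀ m → P m → k ≤ m)

  sumV : (Fin n → ℕ) → ℕ
  sumV f = sum (map f (allFin n))

  IPFeasible : Subset n → (Fin n → ℕ) → Set
  IPFeasible X p =
      (∀ F → IsFort F → 1 ≤ sumV (λ v → if lookup (NS F) v then p v else 0))
    × (∀ v → v ∈ X → p v ≡ 1)
    × (∀ v → p v ≡ 0 ⊎ p v ≡ 1)

  IPValue : Subset n → ℕ → Set
  IPValue X m = ∃ λ (p : Fin n → ℕ) → IPFeasible X p × sumV p ≡ m

  PDSize : Subset n → ℕ → Set
  PDSize X m = ∃ λ (S : Subset n) → X ⊆ S × IsPDS S × ∣ S ∣ ≡ m

-- A set S is power dominating iff N[S] meets every fort.  If the propagation
-- started from N[S] halts at T ≠ V, then V ∖ T is a fort (a vertex of T with a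
-- single neighbour outside T would still propagate) and it avoids N[S].
-- Conversely, propagation can never enter a fort F disjoint from N[S]: the first
-- vertex of F to be observed would be the unique F-neighbour of the vertex
-- forcing it.  As N[F] ∩ S ≠ ∅ iff N[S] ∩ F ≠ ∅, indicator vectors identify the
-- power dominating sets containing X with the feasible points of the integer
-- program, |S| being the objective value; both minima are the least such |S|.
module Submission where

open import Defs
open import Data.Nat using (ℕ; zero; suc; _+_; _≤_; _<_; _≟_; _≡ᵇ_; z≤n; s≤s)
open import Data.Nat.Properties
  using (≤-refl; ≤-trans; ≤-reflexive; ≤-antisym; +-suc; +-identityʳ; +-monoˡ-≤; m≤n+m; <⇒≱; ≮⇒≥; m<1+n⇒m<n∨m≡n)
open import Data.Bool using (true; false; if_then_else_; _∧_)
open import Data.Fin using (Fin; zero; suc)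
open import Data.Fin.Subset
  using (Subset; inside; outside; ⁅_⁆; _∈_; _∉_; _⊆_; _∪_; _∩_; _─_; ∁; ⋃; ∣_∣; Nonempty; ⊥; ⊤)
open import Data.Fin.Subset.Properties
  using ( _∈?_; _⊆?_; nonempty?; anySubset?; Empty-unique; ∉⊥; ∣⊥∣≡0; ∈⊤; ⊆⊤; ∣⊤∣≡n; ∣p∣≤n; ∣p∣≤∣x∷p∣
        ; x∈⁅x⁆; x∈⁅y⁆⇒x≡y; ⊆-antisym; p⊆q⇒∣p∣≤∣q∣; p⊂q⇒∣p∣<∣q∣; p⊆p∪q; q⊆p∪q
        ; x∈p∪q⁺; x∈p∪q⁻; x∈p∩q⁺; x∈p∩q⁻; x∈∁p⇒x∉p; x∉∁p⇒x∈p; x∉p⇒x∈∁p )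
open import Data.Fin.Properties using (any?; all?)
open import Data.List using (List; []; _∷_; allFin; map)
import Data.List as List
open import Data.List.Properties using (map-tabulate; map-cong)
open import Data.List.Relation.Unary.Any using (Any; here; there; satisfied)
import Data.List.Relation.Unary.Any.Properties as Any
open import Data.List.Membership.Propositional using (lose)
open import Data.List.Membership.Propositional.Properties using (∈-allFin)
open import Data.Nat.ListAction using (sum)
open import Data.Vec using (_∷_; []; here; there; tabulate; lookup)
open import Data.Vec.Properties using ([]=⇒lookup; lookup⇒[]=; lookup∘tabulate; lookup-zipWith)
open import Data.Product using (∃; _×_; _,_)
open import Data.Sum using (_⊎_; inj₁; inj₂; [_,_])
open import Data.Empty using (⊥-elim)
open import Function using (id; _∘_)
open import Function.Bundles using (_⇔_; mk⇔; Equivalence)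
open import Relation.Nullary using (¬_; Dec; yes; no; contradiction)
open import Relation.Nullary.Decidable using (_×-dec_; _→-dec_; ¬?; decidable-stable)
open import Relation.Binary.PropositionalEquality using (_≡_; refl; sym; trans; cong; subst; module ≡-Reasoning)

private variable n : ℕ

p─q≡p∩∁q : (p q : Subset n) → p ─ q ≡ p ∩ ∁ q
p─q≡p∩∁q []            []            = refl
p─q≡p∩∁q (inside  ∷ p) (inside  ∷ q) = cong (outside ∷_) (p─q≡p∩∁q p q)
p─q≡p∩∁q (inside  ∷ p) (outside ∷ q) = cong (inside  ∷_) (p─q≡p∩∁q p q)
p─q≡p∩∁q (outside ∷ p) (inside  ∷ q) = cong (outside ∷_) (p─q≡p∩∁q p q)
p─q≡p∩∁q (outside ∷ p) (outside ∷ q) = cong (outside ∷_) (p─q≡p∩∁q p q)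

x∈p⇒1≤∣p∣ : ∀ {x} {p : Subset n} → x ∈ p → 1 ≤ ∣ p ∣
x∈p⇒1≤∣p∣ {p = inside ∷ p} here = s≤s z≤n
x∈p⇒1≤∣p∣ {p = s ∷ p} (there x∈p) = ≤-trans (x∈p⇒1≤∣p∣ x∈p) (∣p∣≤∣x∷p∣ s p)

1≤∣p∣⇒Nonempty : {p : Subset n} → 1 ≤ ∣ p ∣ → Nonempty p
1≤∣p∣⇒Nonempty {n} {p} 1≤∣p∣ with nonempty? p
... | yes ne = ne
... | no ¬ne = contradiction (subst (1 ≤_) (trans (cong ∣_∣ (Empty-unique ¬ne)) (∣⊥∣≡0 n)) 1≤∣p∣) λ ()

q─p≢∅⇒∣p∣<∣p∪q∣ : {p q : Subset n} → Nonempty (q ─ p) → ∣ p ∣ < ∣ p ∪ q ∣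
q─p≢∅⇒∣p∣<∣p∪q∣ {p = p} {q = q} (x , x∈q─p)
  with x∈p∩q⁻ q (∁ p) (subst (x ∈_) (p─q≡p∩∁q q p) x∈q─p)
... | x∈q , x∈∁p = p⊂q⇒∣p∣<∣q∣ (p⊆p∪q q , x , q⊆p∪q p q x∈q , x∈∁p⇒x∉p x∈∁p)

x∈⋃ps⁻ : ∀ {x} (ps : List (Subset n)) → x ∈ ⋃ ps → Any (x ∈_) ps
x∈⋃ps⁻ []       x∈⋃ = ⊥-elim (∉⊥ x∈⋃)
x∈⋃ps⁻ (p ∷ ps) x∈⋃ with x∈p∪q⁻ p (⋃ ps) x∈⋃
... | inj₁ x∈p  = here x∈p
... | inj₂ x∈ps = there (x∈⋃ps⁻ ps x∈ps)

x∈⋃ps⁺ : ∀ {x} {ps : List (Subset n)} → Any (x ∈_) ps → x ∈ ⋃ ps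
x∈⋃ps⁺ (here x∈p)   = x∈p∪q⁺ (inj₁ x∈p)
x∈⋃ps⁺ (there x∈ps) = x∈p∪q⁺ (inj₂ (x∈⋃ps⁺ x∈ps))

allSubsets? : {P : Subset n → Set} → (∀ p → Dec (P p)) → Dec (∀ p → P p)
allSubsets? P? with anySubset? (¬? ∘ P?)
... | yes (p , ¬Pp) = no λ ∀P → ¬Pp (∀P p)
... | no ∄¬P        = yes λ p → decidable-stable (P? p) (λ ¬Pp → ∄¬P (p , ¬Pp))

indicator : Subset n → Fin n → ℕ
indicator S v = if lookup S v then 1 else 0

sum-indicator : (S : Subset n) → sum (map (indicator S) (allFin n)) ≡ ∣ S ∣
sum-indicator {n = zero}  []      = refl
sum-indicator {n = suc n} (b ∷ S) = begin
  indicator (b ∷ S) zero + sum (map (indicator (b ∷ S)) (List.tabulate suc))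
    ≡⟨ cong (λ xs → indicator (b ∷ S) zero + sum xs)
            (trans (map-tabulate suc (indicator (b ∷ S))) (sym (map-tabulate id (indicator S)))) ⟩
  indicator (b ∷ S) zero + sum (map (indicator S) (allFin n))
    ≡⟨ cong (indicator (b ∷ S) zero +_) (sum-indicator S) ⟩
  indicator (b ∷ S) zero + ∣ S ∣
    ≡⟨ count-head b ⟩
  ∣ b ∷ S ∣ ∎
  where
  open ≡-Reasoning
  count-head : ∀ b → (if b then 1 else 0) + ∣ S ∣ ≡ ∣ b ∷ S ∣
  count-head true  = refl
  count-head false = refl

indicator-∩ : (A S : Subset n) (v : Fin n) →
              (if lookup A v then indicator S v else 0) ≡ indicator (A ∩ S) v
indicator-∩ A S v rewrite lookup-zipWith _∧_ v A S with lookup A v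
... | true  = refl
... | false = refl

sum-masked-indicator : (A S : Subset n) →
  sum (map (λ v → if lookup A v then indicator S v else 0) (allFin n)) ≡ ∣ A ∩ S ∣
sum-masked-indicator A S =
  trans (cong sum (map-cong (indicator-∩ A S) (allFin _))) (sum-indicator (A ∩ S))

indicator-∈ : ∀ {S : Subset n} {v} → v ∈ S → indicator S v ≡ 1
indicator-∈ v∈S rewrite []=⇒lookup v∈S = refl

indicator-01 : (S : Subset n) (v : Fin n) → indicator S v ≡ 0 ⊎ indicator S v ≡ 1
indicator-01 S v with lookup S v
... | true  = inj₂ refl
... | false = inj₁ refl

support : (Fin n → ℕ) → Subset n
support p = tabulate (λ v → p v ≡ᵇ 1)

∈-support : ∀ {p : Fin n → ℕ} {v} → p v ≡ 1 → v ∈ support p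
∈-support {p = p} {v} pv≡1 =
  lookup⇒[]= v (support p) (trans (lookup∘tabulate _ v) (cong (_≡ᵇ 1) pv≡1))

indicator-support : (p : Fin n → ℕ) → (∀ v → p v ≡ 0 ⊎ p v ≡ 1) →
                    ∀ v → p v ≡ indicator (support p) v
indicator-support p p01 v rewrite lookup∘tabulate (λ v → p v ≡ᵇ 1) v with p01 v
... | inj₁ pv≡0 rewrite pv≡0 = refl
... | inj₂ pv≡1 rewrite pv≡1 = refl

sum-support : (p : Fin n → ℕ) → (∀ v → p v ≡ 0 ⊎ p v ≡ 1) →
              sum (map p (allFin n)) ≡ ∣ support p ∣
sum-support p p01 =
  trans (cong sum (map-cong (indicator-support p p01) (allFin _))) (sum-indicator (support p))

Least : (ℕ → Set) → ℕ → Set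
Least P k = P k × (∀ m → P m → k ≤ m)

Least-resp-⇔ : {P Q : ℕ → Set} {k : ℕ} → (∀ m → P m ⇔ Q m) → Least P k → Least Q k
Least-resp-⇔ {k = k} P⇔Q (Pk , k≤) =
  Equivalence.to (P⇔Q k) Pk , λ m Qm → k≤ m (Equivalence.from (P⇔Q m) Qm)

module _ {P : ℕ → Set} (P? : ∀ m → Dec (P m)) where

  least-or-none-below : ∀ b → ∃ (Least P) ⊎ (∀ m → m < b → ¬ P m)
  least-or-none-below zero = inj₂ λ _ ()
  least-or-none-below (suc b) with least-or-none-below b
  ... | inj₁ least = inj₁ least
  ... | inj₂ none with P? b
  ...   | yes Pb = inj₁ (b , Pb , λ m Pm → ≮⇒≥ λ m<b → none m m<b Pm)
  ...   | no ¬Pb = inj₂ λ m m<1+b →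
            [ none m , (λ { refl → ¬Pb }) ] (m<1+n⇒m<n∨m≡n m<1+b)

  least-witness : ∀ {b} → P b → ∃ (Least P)
  least-witness {b} Pb with least-or-none-below (suc b)
  ... | inj₁ least = least
  ... | inj₂ none  = contradiction Pb (none b ≤-refl)

module _ (G : Graph n) where
  open Graph G

  ∈N⁻ : ∀ {v x} → x ∈ N G v → adj v x ≡ true
  ∈N⁻ {v} {x} x∈Nv = trans (sym (lookup∘tabulate (adj v) x)) ([]=⇒lookup x∈Nv)

  ∈N⁺ : ∀ {v x} → adj v x ≡ true → x ∈ N G v
  ∈N⁺ {v} {x} vx = lookup⇒[]= x (N G v) (trans (lookup∘tabulate (adj v) x) vx)

  u∈Nc[u] : ∀ u → u ∈ Nc G u
  u∈Nc[u] u = x∈p∪q⁺ (inj₁ (x∈⁅x⁆ u))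

  ∈Nc-sym : ∀ {u x} → x ∈ Nc G u → u ∈ Nc G x
  ∈Nc-sym {u} {x} x∈Nc[u] with x∈p∪q⁻ ⁅ u ⁆ (N G u) x∈Nc[u]
  ... | inj₁ x∈⁅u⁆ rewrite x∈⁅y⁆⇒x≡y u x∈⁅u⁆ = u∈Nc[u] u
  ... | inj₂ x∈Nu = x∈p∪q⁺ (inj₂ (∈N⁺ (trans (symm x u) (∈N⁻ x∈Nu))))

  private
    ∈-if⊥⁻ : ∀ {b} {p : Subset n} {x} → x ∈ (if b then p else ⊥) → b ≡ true × x ∈ p
    ∈-if⊥⁻ {true}  x∈p = refl , x∈p
    ∈-if⊥⁻ {false} x∈⊥ = ⊥-elim (∉⊥ x∈⊥)

  ∈NS⁻ : ∀ {S x} → x ∈ NS G S → ∃ λ u → u ∈ S × x ∈ Nc G u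
  ∈NS⁻ {S} x∈NS
    with satisfied (Any.map⁻ (x∈⋃ps⁻ (map (λ v → if lookup S v then Nc G v else ⊥) (allFin n)) x∈NS))
  ... | u , x∈if with ∈-if⊥⁻ {lookup S u} x∈if
  ...   | Su , x∈Nc[u] = u , lookup⇒[]= u S Su , x∈Nc[u]

  ∈NS⁺ : ∀ {S u x} → u ∈ S → x ∈ Nc G u → x ∈ NS G S
  ∈NS⁺ {S} {u} {x} u∈S x∈Nc[u] =
    x∈⋃ps⁺ (Any.map⁺ (lose (∈-allFin u)
      (subst (λ b → x ∈ (if b then Nc G u else ⊥)) (sym ([]=⇒lookup u∈S)) x∈Nc[u])))

  NS-meets-sym : ∀ {A B} → Nonempty (NS G A ∩ B) → Nonempty (NS G B ∩ A)
  NS-meets-sym {A} {B} (x , x∈NS[A]∩B) with x∈p∩q⁻ (NS G A) B x∈NS[A]∩B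
  ... | x∈NS[A] , x∈B with ∈NS⁻ x∈NS[A]
  ...   | u , u∈A , x∈Nc[u] = u , x∈p∩q⁺ (∈NS⁺ x∈B (∈Nc-sym x∈Nc[u]) , u∈A)

  NS⊆run : ∀ {S T} → PDRun G S T → NS G S ⊆ T
  NS⊆run start                = id
  NS⊆run (step v run _ _) x∈NS = p⊆p∪q (N G v) (NS⊆run run x∈NS)

  propagation-grows : ∀ {T v} → ∣ N G v ─ T ∣ ≡ 1 → ∣ T ∣ < ∣ T ∪ N G v ∣
  propagation-grows {T} {v} one =
    q─p≢∅⇒∣p∣<∣p∪q∣ {p = T} {q = N G v} (1≤∣p∣⇒Nonempty (≤-reflexive (sym one)))

  halting-run-from : ∀ {S T} d → PDRun G S T → n ≤ ∣ T ∣ + d →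
                     ∃ λ T′ → PDRun G S T′ × Halted G T′
  halting-run-from {T = T} d run bound with any? (λ v → (v ∈? T) ×-dec (∣ N G v ─ T ∣ ≟ 1))
  ... | no ¬forcing = T , run , λ v v∈T one → ¬forcing (v , v∈T , one)
  ... | yes (v , v∈T , one) with d
  ...   | zero = contradiction
          (≤-trans (∣p∣≤n (T ∪ N G v)) (≤-trans bound (≤-reflexive (+-identityʳ _))))
          (<⇒≱ (propagation-grows one))
  ...   | suc d = halting-run-from d (step v run v∈T one)
          (≤-trans bound (≤-trans (≤-reflexive (+-suc _ d)) (+-monoˡ-≤ d (propagation-grows one))))

  halting-run : ∀ S → ∃ λ T → PDRun G S T × Halted G T
  halting-run S = halting-run-from n start (m≤n+m n _)

  ∁-halted-isFort : ∀ {T} → Halted G T → Nonempty (∁ T) → IsFort G (∁ T)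
  ∁-halted-isFort {T} halted ne = ne , λ v v∉∁T one →
    halted v (x∉∁p⇒x∈p v∉∁T) (trans (cong ∣_∣ (p─q≡p∩∁q (N G v) T)) one)

  run-avoids-fort : ∀ {S T F} → IsFort G F → (∀ w → w ∈ NS G S → w ∉ F) →
                    PDRun G S T → ∀ w → w ∈ T → w ∉ F
  run-avoids-fort fort disjoint start = disjoint
  run-avoids-fort {F = F} fort@(_ , no-single) disjoint (step {T} v run v∈T one) w w∈T∪Nv w∈F =
    [ (λ w∈T → avoids w w∈T w∈F) , forced ] (x∈p∪q⁻ T (N G v) w∈T∪Nv)
    where
    avoids : ∀ w → w ∈ T → w ∉ F
    avoids = run-avoids-fort fort disjoint run
    unobserved : N G v ∩ F ⊆ N G v ─ T
    unobserved y∈Nv∩F with x∈p∩q⁻ (N G v) F y∈Nv∩F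
    ... | y∈Nv , y∈F = subst (_ ∈_) (sym (p─q≡p∩∁q (N G v) T))
                         (x∈p∩q⁺ (y∈Nv , x∉p⇒x∈∁p (λ y∈T → avoids _ y∈T y∈F)))
    forced : w ∉ N G v
    forced w∈Nv = no-single v (avoids v v∈T) (≤-antisym
      (subst (∣ N G v ∩ F ∣ ≤_) one (p⊆q⇒∣p∣≤∣q∣ unobserved))
      (x∈p⇒1≤∣p∣ (x∈p∩q⁺ (w∈Nv , w∈F))))

  HitsForts : Subset n → Set
  HitsForts S = ∀ F → IsFort G F → Nonempty (NS G F ∩ S)

  isPDS⇒hitsForts : ∀ {S} → IsPDS G S → HitsForts S
  isPDS⇒hitsForts {S} pds F fort@((w , w∈F) , _) with nonempty? (NS G F ∩ S) | halting-run S
  ... | yes hit | _ = hit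
  ... | no miss | T , run , halted =
    ⊥-elim (run-avoids-fort fort disjoint run w (subst (w ∈_) (sym (pds T run halted)) ∈⊤) w∈F)
    where
    disjoint : ∀ w → w ∈ NS G S → w ∉ F
    disjoint w w∈NS w∈F = miss (NS-meets-sym (w , x∈p∩q⁺ (w∈NS , w∈F)))

  hitsForts⇒isPDS : ∀ {S} → HitsForts S → IsPDS G S
  hitsForts⇒isPDS {S} hits T run halted = ⊆-antisym ⊆⊤ λ {x} _ → observed x
    where
    observed : ∀ x → x ∈ T
    observed x with x ∈? T
    ... | yes x∈T = x∈T
    ... | no x∉T with NS-meets-sym (hits (∁ T) (∁-halted-isFort halted (x , x∉p⇒x∈∁p x∉T)))
    ...   | w , w∈NS∩∁T with x∈p∩q⁻ (NS G S) (∁ T) w∈NS∩∁T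
    ...     | w∈NS , w∈∁T = contradiction (NS⊆run run w∈NS) (x∈∁p⇒x∉p w∈∁T)

  isFort? : ∀ F → Dec (IsFort G F)
  isFort? F = nonempty? F ×-dec all? (λ v → ¬? (v ∈? F) →-dec ¬? (∣ N G v ∩ F ∣ ≟ 1))

  hitsForts? : ∀ S → Dec (HitsForts S)
  hitsForts? S = allSubsets? λ F → isFort? F →-dec nonempty? (NS G F ∩ S)

  module _ (X : Subset n) where

    HittingSize : ℕ → Set
    HittingSize m = ∃ λ S → X ⊆ S × HitsForts S × ∣ S ∣ ≡ m

    hittingSize? : ∀ m → Dec (HittingSize m)
    hittingSize? m = anySubset? λ S → (X ⊆? S) ×-dec hitsForts? S ×-dec (∣ S ∣ ≟ m)

    hittingSize-⊤ : HittingSize n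
    hittingSize-⊤ =
      ⊤ , ⊆⊤ , (λ F ((w , w∈F) , _) → w , x∈p∩q⁺ (∈NS⁺ w∈F (u∈Nc[u] w) , ∈⊤)) , ∣⊤∣≡n n

    HittingSize⇔PDSize : ∀ m → HittingSize m ⇔ PDSize G X m
    HittingSize⇔PDSize _ = mk⇔
      (λ (S , X⊆S , hits , size) → S , X⊆S , hitsForts⇒isPDS hits , size)
      (λ (S , X⊆S , pds , size) → S , X⊆S , isPDS⇒hitsForts pds , size)

    indicator-feasible : ∀ {S} → X ⊆ S → HitsForts S → IPFeasible G X (indicator S)
    indicator-feasible {S} X⊆S hits =
      (λ F fort → let (x , x∈) = hits F fort in
        subst (1 ≤_) (sym (sum-masked-indicator (NS G F) S)) (x∈p⇒1≤∣p∣ x∈)) ,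
      (λ v v∈X → indicator-∈ (X⊆S v∈X)) ,
      indicator-01 S

    support-hitsForts : ∀ {p} → IPFeasible G X p → HitsForts (support p)
    support-hitsForts {p} (forts , _ , p01) F fort =
      1≤∣p∣⇒Nonempty (subst (1 ≤_) constraint (forts F fort))
      where
      p≗indicator : ∀ v → (if lookup (NS G F) v then p v else 0)
                        ≡ (if lookup (NS G F) v then indicator (support p) v else 0)
      p≗indicator v = cong (if lookup (NS G F) v then_else 0) (indicator-support p p01 v)
      constraint : sumV G (λ v → if lookup (NS G F) v then p v else 0) ≡ ∣ NS G F ∩ support p ∣
      constraint = trans (cong sum (map-cong p≗indicator (allFin n)))
                         (sum-masked-indicator (NS G F) (support p))

    HittingSize⇔IPValue : ∀ m → HittingSize m ⇔ IPValue G X m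
    HittingSize⇔IPValue _ = mk⇔
      (λ (S , X⊆S , hits , size) →
        indicator S , indicator-feasible X⊆S hits , trans (sum-indicator S) size)
      (λ (p , feasible@(_ , onX , p01) , value) →
        support p , (λ v∈X → ∈-support {p = p} (onX _ v∈X)) , support-hitsForts feasible ,
        trans (sym (sum-support p p01)) value)

theorem4p4 : ∀ {n : ℕ} (G : Graph n) (X : Subset n) →
    ∃ λ (k : ℕ) → IsMin G (IPValue G X) k × IsMin G (PDSize G X) k
theorem4p4 G X =
  let k , least = least-witness (hittingSize? G X) (hittingSize-⊤ G X)
  in  k , Least-resp-⇔ (HittingSize⇔IPValue G X) least
        , Least-resp-⇔ (HittingSize⇔PDSize G X) least
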